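{- Let $\ell\geqslant2$ be an even integer and $V=\langle e_1\rangle\times\langle e_2\rangle\times\cdots\times\langle e_\ell\rangle$ a group with involutions $e_1,\dots,e_\ell$ (an elementary abelian $2$-group of rank $\ell$). Let $r$ be the right regular representation of $V$, $\omega=r(e_{\ell-1}e_\ell)$, $e_{ -1}=e_0=1$, and let $\chi,\psi$ be the automorphisms of $V$ with $e_{2i+1}^\chi=e_{2i+1}$, $e_{2i+2}^\chi=e_{2i+1}e_{2i+2}$, $e_{2i+1}^\psi=e_{2i-1}e_{2i}e_{2i+2}$ and $e_{2i+2}^\psi=e_{2i-1}e_{2i}e_{2i+1}$ for each $0\leqslant i\leqslant(\ell-2)/2$. Then $\langle\chi,\psi,\omega\rangle$ is a transitive subgroup of $\mathrm{Sym}(V)$.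
   Context: Permutations act on the right, written exponentially. The right regular representation $r$ sends $g\in V$ to the permutation $u\mapsto ug$ of $V$. -}

module Defs where

open import Data.Bool using (Bool; true; false; if_then_else_; _xor_)
open import Data.Nat using (ℕ; zero; suc; _+_; _*_; _∸_; _<?_; _/_; _%_)
open import Data.Nat.Divisibility using (_∣_)
open import Data.Fin using (Fin; toℕ; fromℕ<; _≟_)
open import Data.Vec using (Vec; zipWith; replicate; tabulate; foldr′)
open import Data.Product using (Σ; _×_)
open import Function using (id; _∘_)
open import Relation.Nullary using (yes; no)
open import Relation.Nullary.Decidable using (⌊_⌋)
open import Relation.Binary.PropositionalEquality using (_≡_)

-- V = elementary abelian 2-group of rank ℓ, written as 𝔽₂^ℓ (bit vectors);
-- the group operation is coordinatewise xor, identity is the zero vector.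
V : ℕ → Set
V ℓ = Vec Bool ℓ

_⊕_ : ∀ {ℓ} → V ℓ → V ℓ → V ℓ
_⊕_ = zipWith _xor_

𝟙 : ∀ {ℓ} → V ℓ
𝟙 {ℓ} = replicate ℓ false

-- basis involution (0-indexed): the paper's e_{k+1} is basis k
basis : ∀ {ℓ} → Fin ℓ → V ℓ
basis {ℓ} j = tabulate (λ k → ⌊ j ≟ k ⌋)

-- 1-indexed paper generators: E 0 = e_0 = 1, E k = e_k for 1 ≤ k ≤ ℓ
-- (out-of-range indices never occur below; they are sent to 1)
E : ∀ ℓ → ℕ → V ℓ
E ℓ zero = 𝟙
E ℓ (suc k) with k <? ℓ
... | yes k<ℓ = basis (fromℕ< k<ℓ)
... | no _ = 𝟙

linExt : ∀ {ℓ} → (Fin ℓ → V ℓ) → V ℓ → V ℓ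
linExt img x = foldr′ _⊕_ 𝟙 (zipWith (λ b v → if b then v else 𝟙) x (tabulate img))

-- e_{2i-1} e_{2i}, which equals 1 for i = 0 since e_{-1} = e_0 = 1
-- (2*0 ∸ 1 = 0 and E ℓ 0 = 1)
prev : ∀ ℓ → ℕ → V ℓ
prev ℓ i = E ℓ (2 * i ∸ 1) ⊕ E ℓ (2 * i)

-- χ : e_{2i+1} ↦ e_{2i+1},  e_{2i+2} ↦ e_{2i+1} e_{2i+2}
-- basis j is e_{k+1} with k = toℕ j; k = 2i gives e_{2i+1}, k = 2i+1 gives e_{2i+2}
χ-img : ∀ ℓ → Fin ℓ → V ℓ
χ-img ℓ j with toℕ j % 2
... | zero = E ℓ (2 * (toℕ j / 2) + 1)
... | suc _ = E ℓ (2 * (toℕ j / 2) + 1) ⊕ E ℓ (2 * (toℕ j / 2) + 2)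

ψ-img : ∀ ℓ → Fin ℓ → V ℓ
ψ-img ℓ j with toℕ j % 2
... | zero = prev ℓ (toℕ j / 2) ⊕ E ℓ (2 * (toℕ j / 2) + 2)
... | suc _ = prev ℓ (toℕ j / 2) ⊕ E ℓ (2 * (toℕ j / 2) + 1)

χ : ∀ ℓ → V ℓ → V ℓ
χ ℓ = linExt (χ-img ℓ)

ψ : ∀ ℓ → V ℓ → V ℓ
ψ ℓ = linExt (ψ-img ℓ)

r : ∀ {ℓ} → V ℓ → V ℓ → V ℓ
r g u = u ⊕ g

ω : ∀ ℓ → V ℓ → V ℓ
ω ℓ = r (E ℓ (ℓ ∸ 1) ⊕ E ℓ ℓ)

-- The subgroup ⟨a, b, c⟩ of Sym(X): smallest set of maps containing the
-- generators and the identity, closed under products (right action: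
-- u^{fg} = (u^f)^g), under inverses, and under extensional equality.
data ⟨_,_,_⟩ {X : Set} (a b c : X → X) : (X → X) → Set where
  gen₁ : ⟨ a , b , c ⟩ a
  gen₂ : ⟨ a , b , c ⟩ b
  gen₃ : ⟨ a , b , c ⟩ c
  one  : ⟨ a , b , c ⟩ id
  mul  : ∀ {f g} → ⟨ a , b , c ⟩ f → ⟨ a , b , c ⟩ g → ⟨ a , b , c ⟩ (g ∘ f)
  inv  : ∀ {f g} → ⟨ a , b , c ⟩ f → (∀ x → g (f x) ≡ x) → (∀ x → f (g x) ≡ x)
       → ⟨ a , b , c ⟩ g
  ext  : ∀ {f g} → ⟨ a , b , c ⟩ f → (∀ x → f x ≡ g x) → ⟨ a , b , c ⟩ g

Transitive : {X : Set} → ((X → X) → Set) → Set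
Transitive {X} G = ∀ (u v : X) → Σ (X → X) (λ g → G g × g u ≡ v)

-- χ and ψ are linear extensions, hence additive, and each squares to the identity on
-- every generator e_k, so both are involutive automorphisms of V; ω is a translation.
-- Conjugating a translation r(w) by an additive involution f gives r(f w), so the
-- translations in ⟨χ, ψ, ω⟩ form a subgroup stable under χ and ψ. Starting from
-- ω = r(e_{ℓ-1} e_ℓ) and descending through the pairs (e_{2i+1}, e_{2i+2}), χ turns
-- e_{2i+1} e_{2i+2} into e_{2i+2}, whence also e_{2i+1}, and ψ(e_{2i+1}) e_{2i+2} =
-- e_{2i-1} e_{2i} passes to the previous pair. So every r(e_k), hence every
-- translation, lies in the group, which is therefore transitive.

module Submission where

open import Defs
open import Data.Nat using (ℕ; _≤_)
open import Data.Nat.Divisibility using (_∣_)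
open import Data.Product using (_×_)
open import Function.Definitions using (Bijective)
open import Relation.Binary.PropositionalEquality using (_≡_)

open import Algebra.Bundles using (CommutativeRing)
open import Algebra.Definitions using (Involutive)
open import Data.Bool using (Bool; true; false; if_then_else_; _xor_)
open import Data.Bool.Properties
  using (xor-assoc; xor-comm; xor-identityˡ; xor-identityʳ; xor-same; xor-∧-commutativeRing)
open import Algebra.Properties.CommutativeSemigroup
  (CommutativeRing.+-commutativeSemigroup xor-∧-commutativeRing) using (interchange)
open import Data.Fin using (Fin; toℕ; fromℕ<; _≟_) renaming (zero to fzero; suc to fsuc)
open import Data.Fin.Properties using (fromℕ<-toℕ; toℕ-fromℕ<; toℕ<n)
open import Data.Nat using (zero; suc; _+_; _*_; _∸_; _<_; _/_; _%_; _<?_; s≤s; z≤n; s≤s⁻¹)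
open import Data.Nat.DivMod
  using (m≡m%n+[m/n]*n; m%n<n; [m+kn]%n≡m%n; m<n⇒m%n≡m; +-distrib-/-∣ʳ; m<n⇒m/n≡0; m*n/n≡m; m<n*o⇒m/o<n)
open import Data.Nat.Divisibility using (divides)
open import Data.Nat.Properties using (+-comm; *-comm; *-suc; <⇒≤; n<1+n; m<n⇒m<1+n; m≤n⇒m<n∨m≡n; *-monoˡ-≤)
open import Data.Product using (_,_)
open import Data.Sum using (inj₁; inj₂)
open import Data.Vec using (_∷_; []; tabulate; foldr′; zipWith)
open import Data.Vec.Properties using (zipWith-assoc; zipWith-comm; zipWith-identityˡ; zipWith-identityʳ; tabulate-cong)
open import Function using (_∘_)
open import Function.Bundles using (Bijection; mk↔ₛ′)
open import Function.Properties.Inverse using (↔⇒⤖)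
open import Relation.Binary.PropositionalEquality
  using (refl; sym; trans; cong; cong₂; subst; module ≡-Reasoning)
open import Relation.Nullary using (yes; no; contradiction)
open import Relation.Nullary.Decidable using (⌊⌋-map′)

open ≡-Reasoning

private
  variable
    k m n p i q : ℕ

⊕-assoc : (x y z : V n) → (x ⊕ y) ⊕ z ≡ x ⊕ (y ⊕ z)
⊕-assoc = zipWith-assoc xor-assoc

⊕-comm : (x y : V n) → x ⊕ y ≡ y ⊕ x
⊕-comm = zipWith-comm xor-comm

⊕-identityˡ : (x : V n) → 𝟙 ⊕ x ≡ x
⊕-identityˡ = zipWith-identityˡ xor-identityˡ

⊕-identityʳ : (x : V n) → x ⊕ 𝟙 ≡ x
⊕-identityʳ = zipWith-identityʳ xor-identityʳ

⊕-self : (x : V n) → x ⊕ x ≡ 𝟙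
⊕-self []      = refl
⊕-self (a ∷ x) = cong₂ _∷_ (xor-same a) (⊕-self x)

⊕-interchange : (x y z w : V n) → (x ⊕ y) ⊕ (z ⊕ w) ≡ (x ⊕ z) ⊕ (y ⊕ w)
⊕-interchange []      []      []      []      = refl
⊕-interchange (a ∷ x) (b ∷ y) (c ∷ z) (d ∷ w) = cong₂ _∷_ (interchange a b c d) (⊕-interchange x y z w)

⊕-cancelˡ : (x y : V n) → x ⊕ (x ⊕ y) ≡ y
⊕-cancelˡ x y = begin
  x ⊕ (x ⊕ y)  ≡⟨ sym (⊕-assoc x x y) ⟩
  (x ⊕ x) ⊕ y  ≡⟨ cong (_⊕ y) (⊕-self x) ⟩
  𝟙 ⊕ y        ≡⟨ ⊕-identityˡ y ⟩
  y            ∎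

⊕-cancelʳ : (x y : V n) → (x ⊕ y) ⊕ y ≡ x
⊕-cancelʳ x y = begin
  (x ⊕ y) ⊕ y  ≡⟨ ⊕-assoc x y y ⟩
  x ⊕ (y ⊕ y)  ≡⟨ cong (x ⊕_) (⊕-self y) ⟩
  x ⊕ 𝟙        ≡⟨ ⊕-identityʳ x ⟩
  x            ∎

r-involutive : (g : V n) → Involutive _≡_ (r g)
r-involutive g u = ⊕-cancelʳ u g

Additive : (V m → V n) → Set
Additive f = ∀ x y → f (x ⊕ y) ≡ f x ⊕ f y

additive-𝟙 : {f : V m → V n} → Additive f → f 𝟙 ≡ 𝟙
additive-𝟙 {f = f} f-add = begin
  f 𝟙          ≡⟨ cong f (sym (⊕-identityˡ 𝟙)) ⟩
  f (𝟙 ⊕ 𝟙)    ≡⟨ f-add 𝟙 𝟙 ⟩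
  f 𝟙 ⊕ f 𝟙    ≡⟨ ⊕-self (f 𝟙) ⟩
  𝟙            ∎

additive-∘ : {f g : V n → V n} → Additive f → Additive g → Additive (f ∘ g)
additive-∘ {f = f} {g} f-add g-add x y = trans (cong f (g-add x y)) (f-add (g x) (g y))

infixr 25 _·_

_·_ : Bool → V n → V n
b · v = if b then v else 𝟙

additive-· : {f : V m → V n} → Additive f → ∀ b v → f (b · v) ≡ b · f v
additive-· f-add false v = additive-𝟙 f-add
additive-· f-add true  v = refl

xor-· : ∀ a b (v : V n) → (a xor b) · v ≡ a · v ⊕ b · v
xor-· false b    v = sym (⊕-identityˡ (b · v))
xor-· true false v = sym (⊕-identityʳ v)
xor-· true true  v = sym (⊕-self v)

combination : (Fin n → V m) → V n → V m
combination img x = foldr′ _⊕_ 𝟙 (zipWith _·_ x (tabulate img))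

combination-additive : (img : Fin n → V m) → Additive (combination img)
combination-additive img []      []      = sym (⊕-identityˡ 𝟙)
combination-additive img (a ∷ x) (b ∷ y) = begin
  (a xor b) · img fzero ⊕ combination (img ∘ fsuc) (x ⊕ y)
    ≡⟨ cong₂ _⊕_ (xor-· a b (img fzero)) (combination-additive (img ∘ fsuc) x y) ⟩
  (a · img fzero ⊕ b · img fzero) ⊕ (combination (img ∘ fsuc) x ⊕ combination (img ∘ fsuc) y)
    ≡⟨ ⊕-interchange _ _ _ _ ⟩
  combination img (a ∷ x) ⊕ combination img (b ∷ y) ∎

combination-cong : {img img′ : Fin n → V m} → (∀ j → img j ≡ img′ j) →
                   ∀ x → combination img x ≡ combination img′ x
combination-cong eq []      = refl
combination-cong eq (b ∷ x) = cong₂ (λ v w → b · v ⊕ w) (eq fzero) (combination-cong (eq ∘ fsuc) x)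

additive-combination : {f : V m → V k} → Additive f → (img : Fin n → V m) →
                       ∀ x → f (combination img x) ≡ combination (f ∘ img) x
additive-combination f-add img []      = additive-𝟙 f-add
additive-combination f-add img (b ∷ x) =
  trans (f-add _ _) (cong₂ _⊕_ (additive-· f-add b (img fzero)) (additive-combination f-add (img ∘ fsuc) x))

combination-closed : (P : V m → Set) → P 𝟙 → (∀ {u w} → P u → P w → P (u ⊕ w)) →
                     (img : Fin n → V m) → (∀ j → P (img j)) → ∀ x → P (combination img x)
combination-closed P P𝟙 P⊕ img Pimg []          = P𝟙
combination-closed P P𝟙 P⊕ img Pimg (b ∷ x) =
  P⊕ (head-closed b) (combination-closed P P𝟙 P⊕ (img ∘ fsuc) (Pimg ∘ fsuc) x)
  where
  head-closed : ∀ b → P (b · img fzero)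
  head-closed false = P𝟙
  head-closed true  = Pimg fzero

tabulate-false : tabulate {n = n} (λ _ → false) ≡ 𝟙
tabulate-false {zero}  = refl
tabulate-false {suc n} = cong (false ∷_) tabulate-false

basis-zero : basis {suc n} fzero ≡ true ∷ 𝟙
basis-zero = cong (true ∷_) tabulate-false

basis-suc : (j : Fin n) → basis (fsuc j) ≡ false ∷ basis j
basis-suc j = cong (false ∷_) (tabulate-cong (λ k → ⌊⌋-map′ _ _ (j ≟ k)))

·-basis-zero : ∀ b → b · basis {suc n} fzero ≡ b ∷ 𝟙
·-basis-zero false = refl
·-basis-zero true  = basis-zero

combination-basis : (img : Fin n → V m) → ∀ j → combination img (basis j) ≡ img j
combination-basis {suc n} img fzero = begin
  combination img (basis fzero)          ≡⟨ cong (combination img) basis-zero ⟩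
  img fzero ⊕ combination (img ∘ fsuc) 𝟙 ≡⟨ cong (img fzero ⊕_) (additive-𝟙 (combination-additive (img ∘ fsuc))) ⟩
  img fzero ⊕ 𝟙                          ≡⟨ ⊕-identityʳ (img fzero) ⟩
  img fzero                              ∎
combination-basis {suc n} img (fsuc j) = begin
  combination img (basis (fsuc j))       ≡⟨ cong (combination img) (basis-suc j) ⟩
  𝟙 ⊕ combination (img ∘ fsuc) (basis j) ≡⟨ ⊕-identityˡ _ ⟩
  combination (img ∘ fsuc) (basis j)     ≡⟨ combination-basis (img ∘ fsuc) j ⟩
  img (fsuc j)                           ∎

combination-spans : (x : V n) → combination basis x ≡ x
combination-spans []      = refl
combination-spans (b ∷ x) = begin
  b · basis fzero ⊕ combination (basis ∘ fsuc) x        ≡⟨ cong₂ _⊕_ (·-basis-zero b) shift ⟩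
  (b ∷ 𝟙) ⊕ (false ∷ x)                                 ≡⟨ cong₂ _∷_ (xor-identityʳ b) (⊕-identityˡ x) ⟩
  b ∷ x                                                 ∎
  where
  shift : combination (basis ∘ fsuc) x ≡ false ∷ x
  shift = begin
    combination (basis ∘ fsuc) x           ≡⟨ combination-cong basis-suc x ⟩
    combination ((false ∷_) ∘ basis) x     ≡⟨ sym (additive-combination {f = false ∷_} (λ _ _ → refl) basis x) ⟩
    false ∷ combination basis x            ≡⟨ cong (false ∷_) (combination-spans x) ⟩
    false ∷ x                              ∎

additive-ext : {f g : V n → V m} → Additive f → Additive g →
               (∀ j → f (basis j) ≡ g (basis j)) → ∀ x → f x ≡ g x
additive-ext {f = f} {g} f-add g-add eq x = begin
  f x                              ≡⟨ cong f (sym (combination-spans x)) ⟩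
  f (combination basis x)          ≡⟨ additive-combination f-add basis x ⟩
  combination (f ∘ basis) x        ≡⟨ combination-cong eq x ⟩
  combination (g ∘ basis) x        ≡⟨ sym (additive-combination g-add basis x) ⟩
  g (combination basis x)          ≡⟨ cong g (combination-spans x) ⟩
  g x                              ∎

additive-involutive : {f : V n → V n} → Additive f →
                      (∀ j → f (f (basis j)) ≡ basis j) → Involutive _≡_ f
additive-involutive f-add = additive-ext (additive-∘ f-add f-add) (λ _ _ → refl)

basis-induction : (P : V n → Set) → P 𝟙 → (∀ {u w} → P u → P w → P (u ⊕ w)) →
                  (∀ j → P (basis j)) → ∀ x → P x
basis-induction P P𝟙 P⊕ Pbasis x =
  subst P (combination-spans x) (combination-closed P P𝟙 P⊕ basis Pbasis x)

involutive⇒bijective : {A : Set} {f : A → A} → Involutive _≡_ f → Bijective _≡_ _≡_ f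
involutive⇒bijective {f = f} f-inv = Bijection.bijective (↔⇒⤖ (mk↔ₛ′ f f f-inv f-inv))

module _ {a b c : V n → V n} where

  translation-𝟙 : ⟨ a , b , c ⟩ (r 𝟙)
  translation-𝟙 = ext one (λ u → sym (⊕-identityʳ u))

  translation-⊕ : ∀ {u w} → ⟨ a , b , c ⟩ (r u) → ⟨ a , b , c ⟩ (r w) → ⟨ a , b , c ⟩ (r (u ⊕ w))
  translation-⊕ {u} {w} ru rw = ext (mul ru rw) (λ x → ⊕-assoc x u w)

  -- Conjugating r w by an additive involution f gives u ↦ f (f u ⊕ w) = u ⊕ f w.
  translation-conjugate : ∀ {f w} → ⟨ a , b , c ⟩ f → Additive f → Involutive _≡_ f →
                          ⟨ a , b , c ⟩ (r w) → ⟨ a , b , c ⟩ (r (f w))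
  translation-conjugate {f} {w} f∈ f-add f-inv rw =
    ext (mul f∈ (mul rw f∈)) (λ u → trans (f-add (f u) w) (cong (_⊕ f w) (f-inv u)))

  translations-from-basis : (∀ j → ⟨ a , b , c ⟩ (r (basis j))) → ∀ w → ⟨ a , b , c ⟩ (r w)
  translations-from-basis = basis-induction (λ w → ⟨ a , b , c ⟩ (r w)) translation-𝟙 translation-⊕

  translations⇒transitive : (∀ w → ⟨ a , b , c ⟩ (r w)) → Transitive ⟨ a , b , c ⟩
  translations⇒transitive rw u v = r (u ⊕ v) , rw (u ⊕ v) , ⊕-cancelˡ u v

E-toℕ : (j : Fin n) → E n (suc (toℕ j)) ≡ basis j
E-toℕ {n} j with toℕ j <? n
... | yes j<n = cong basis (fromℕ<-toℕ j j<n)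
... | no  j≮n = contradiction (toℕ<n j) j≮n

E-suc≡basis : (j : Fin n) → toℕ j ≡ k → E n (suc k) ≡ basis j
E-suc≡basis {n} j toℕj≡k = trans (cong (E n ∘ suc) (sym toℕj≡k)) (E-toℕ j)

[p+i*2]%2≡p : p < 2 → (p + i * 2) % 2 ≡ p
[p+i*2]%2≡p {p} {i} p<2 = trans ([m+kn]%n≡m%n p i 2) (m<n⇒m%n≡m p<2)

[p+i*2]/2≡i : p < 2 → (p + i * 2) / 2 ≡ i
[p+i*2]/2≡i {p} {i} p<2 =
  trans (+-distrib-/-∣ʳ p (divides i refl)) (cong₂ _+_ (m<n⇒m/n≡0 p<2) (m*n/n≡m i 2))

e-odd e-even : ∀ n → ℕ → V n
e-odd  n i = E n (2 * i + 1)
e-even n i = E n (2 * i + 2)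

e-odd≡E : ∀ i → e-odd n i ≡ E n (suc (0 + i * 2))
e-odd≡E {n} i = cong (E n) (trans (+-comm (2 * i) 1) (cong suc (*-comm 2 i)))

e-even≡E : ∀ i → e-even n i ≡ E n (suc (1 + i * 2))
e-even≡E {n} i = cong (E n) (trans (+-comm (2 * i) 2) (cong (2 +_) (*-comm 2 i)))

prev-zero : prev n 0 ≡ 𝟙
prev-zero = ⊕-self 𝟙

prev-suc : ∀ i → prev n (suc i) ≡ e-odd n i ⊕ e-even n i
prev-suc {n} i = begin
  prev n (suc i)                        ≡⟨ cong (λ k → E n (k ∸ 1) ⊕ E n k) (*-suc 2 i) ⟩
  E n (1 + 2 * i) ⊕ E n (2 + 2 * i)     ≡⟨ cong₂ (λ k l → E n k ⊕ E n l) (+-comm 1 (2 * i)) (+-comm 2 (2 * i)) ⟩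
  e-odd n i ⊕ e-even n i                ∎

χ-pair ψ-pair : ∀ n → ℕ → ℕ → V n
χ-pair n zero    i = e-odd n i
χ-pair n (suc _) i = e-odd n i ⊕ e-even n i
ψ-pair n zero    i = prev n i ⊕ e-even n i
ψ-pair n (suc _) i = prev n i ⊕ e-odd n i

χ-img-pair : (j : Fin n) → χ-img n j ≡ χ-pair n (toℕ j % 2) (toℕ j / 2)
χ-img-pair j with toℕ j % 2
... | zero  = refl
... | suc _ = refl

ψ-img-pair : (j : Fin n) → ψ-img n j ≡ ψ-pair n (toℕ j % 2) (toℕ j / 2)
ψ-img-pair j with toℕ j % 2
... | zero  = refl
... | suc _ = refl

linExt-pair : (img : Fin n → V n) (pairImg : ℕ → ℕ → V n) →
              (∀ j → img j ≡ pairImg (toℕ j % 2) (toℕ j / 2)) →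
              ∀ p i → p < 2 → (p+i*2<n : p + i * 2 < n) → linExt img (E n (suc (p + i * 2))) ≡ pairImg p i
linExt-pair {n} img pairImg img≡ p i p<2 p+i*2<n = begin
  linExt img (E n (suc (p + i * 2)))    ≡⟨ cong (linExt img) (E-suc≡basis j toℕj≡) ⟩
  linExt img (basis j)                  ≡⟨ combination-basis img j ⟩
  img j                                 ≡⟨ img≡ j ⟩
  pairImg (toℕ j % 2) (toℕ j / 2)       ≡⟨ cong (λ k → pairImg (k % 2) (k / 2)) toℕj≡ ⟩
  pairImg ((p + i * 2) % 2) ((p + i * 2) / 2)
                                        ≡⟨ cong₂ pairImg ([p+i*2]%2≡p {i = i} p<2) ([p+i*2]/2≡i p<2) ⟩
  pairImg p i                           ∎
  where
  j : Fin n
  j = fromℕ< p+i*2<n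
  toℕj≡ : toℕ j ≡ p + i * 2
  toℕj≡ = toℕ-fromℕ< p+i*2<n

module _ {n : ℕ} (i : ℕ) (pair-in-range : suc (i * 2) < n) where

  private
    odd-in-range : 0 + i * 2 < n
    odd-in-range = <⇒≤ pair-in-range

  χ-e-odd : χ n (e-odd n i) ≡ e-odd n i
  χ-e-odd = trans (cong (χ n) (e-odd≡E i))
                  (linExt-pair (χ-img n) (χ-pair n) χ-img-pair 0 i (s≤s z≤n) odd-in-range)

  χ-e-even : χ n (e-even n i) ≡ e-odd n i ⊕ e-even n i
  χ-e-even = trans (cong (χ n) (e-even≡E i))
                   (linExt-pair (χ-img n) (χ-pair n) χ-img-pair 1 i (s≤s (s≤s z≤n)) pair-in-range)

  ψ-e-odd : ψ n (e-odd n i) ≡ prev n i ⊕ e-even n i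
  ψ-e-odd = trans (cong (ψ n) (e-odd≡E i))
                  (linExt-pair (ψ-img n) (ψ-pair n) ψ-img-pair 0 i (s≤s z≤n) odd-in-range)

  ψ-e-even : ψ n (e-even n i) ≡ prev n i ⊕ e-odd n i
  ψ-e-even = trans (cong (ψ n) (e-even≡E i))
                   (linExt-pair (ψ-img n) (ψ-pair n) ψ-img-pair 1 i (s≤s (s≤s z≤n)) pair-in-range)

χ-additive : Additive (χ n)
χ-additive {n} = combination-additive (χ-img n)

ψ-additive : Additive (ψ n)
ψ-additive {n} = combination-additive (ψ-img n)

χ-prev-suc : ∀ {n} i → suc (i * 2) < n → χ n (prev n (suc i)) ≡ e-even n i
χ-prev-suc {n} i h = begin
  χ n (prev n (suc i))                          ≡⟨ cong (χ n) (prev-suc i) ⟩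
  χ n (e-odd n i ⊕ e-even n i)                  ≡⟨ χ-additive (e-odd n i) (e-even n i) ⟩
  χ n (e-odd n i) ⊕ χ n (e-even n i)            ≡⟨ cong₂ _⊕_ (χ-e-odd i h) (χ-e-even i h) ⟩
  e-odd n i ⊕ (e-odd n i ⊕ e-even n i)          ≡⟨ ⊕-cancelˡ _ _ ⟩
  e-even n i                                    ∎

ψ-prev-suc : ∀ {n} i → suc (i * 2) < n → ψ n (prev n (suc i)) ≡ prev n (suc i)
ψ-prev-suc {n} i h = begin
  ψ n (prev n (suc i))                          ≡⟨ cong (ψ n) (prev-suc i) ⟩
  ψ n (e-odd n i ⊕ e-even n i)                  ≡⟨ ψ-additive (e-odd n i) (e-even n i) ⟩
  ψ n (e-odd n i) ⊕ ψ n (e-even n i)            ≡⟨ cong₂ _⊕_ (ψ-e-odd i h) (ψ-e-even i h) ⟩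
  (prev n i ⊕ e-even n i) ⊕ (prev n i ⊕ e-odd n i)
                                                ≡⟨ ⊕-interchange _ _ _ _ ⟩
  (prev n i ⊕ prev n i) ⊕ (e-even n i ⊕ e-odd n i)
                                                ≡⟨ cong₂ _⊕_ (⊕-self (prev n i)) (⊕-comm _ _) ⟩
  𝟙 ⊕ (e-odd n i ⊕ e-even n i)                  ≡⟨ ⊕-identityˡ _ ⟩
  e-odd n i ⊕ e-even n i                        ≡⟨ sym (prev-suc i) ⟩
  prev n (suc i)                                ∎

ψ-prev : ∀ {n} i → suc (i * 2) < n → ψ n (prev n i) ≡ prev n i
ψ-prev {n} zero    _ = begin
  ψ n (prev n 0)  ≡⟨ cong (ψ n) prev-zero ⟩
  ψ n 𝟙           ≡⟨ additive-𝟙 ψ-additive ⟩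
  𝟙               ≡⟨ sym prev-zero ⟩
  prev n 0        ∎
ψ-prev (suc i) h = ψ-prev-suc i (<⇒≤ (<⇒≤ h))

module _ {n : ℕ} (i : ℕ) (h : suc (i * 2) < n) where

  χ-involutive-on-pair : χ n (χ n (e-odd n i)) ≡ e-odd n i × χ n (χ n (e-even n i)) ≡ e-even n i
  χ-involutive-on-pair =
    trans (cong (χ n) (χ-e-odd i h)) (χ-e-odd i h) ,
    trans (cong (χ n) (trans (χ-e-even i h) (sym (prev-suc i)))) (χ-prev-suc i h)

  ψ-involutive-on-pair : ψ n (ψ n (e-odd n i)) ≡ e-odd n i × ψ n (ψ n (e-even n i)) ≡ e-even n i
  ψ-involutive-on-pair = twice (e-odd n i) (e-even n i) (ψ-e-odd i h) (ψ-e-even i h) ,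
                         twice (e-even n i) (e-odd n i) (ψ-e-even i h) (ψ-e-odd i h)
    where
    twice : ∀ u v → ψ n u ≡ prev n i ⊕ v → ψ n v ≡ prev n i ⊕ u → ψ n (ψ n u) ≡ u
    twice u v ψu ψv = begin
      ψ n (ψ n u)                       ≡⟨ cong (ψ n) ψu ⟩
      ψ n (prev n i ⊕ v)                ≡⟨ ψ-additive (prev n i) v ⟩
      ψ n (prev n i) ⊕ ψ n v            ≡⟨ cong₂ _⊕_ (ψ-prev i h) ψv ⟩
      prev n i ⊕ (prev n i ⊕ u)         ≡⟨ ⊕-cancelˡ _ _ ⟩
      u                                 ∎

downward-induction : (P : ℕ → Set) → P q → (∀ {i} → i < q → P (suc i) → P i) → ∀ {i} → i ≤ q → P i
downward-induction {zero}  P Pq step z≤n = Pq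
downward-induction {suc q} P Pq step i≤1+q with m≤n⇒m<n∨m≡n i≤1+q
... | inj₂ refl  = Pq
... | inj₁ i<1+q = downward-induction P (step (n<1+n q) Pq) (step ∘ m<n⇒m<1+n) (s≤s⁻¹ i<1+q)

module EvenRank (q : ℕ) where

  ℓ : ℕ
  ℓ = q * 2

  pair-in-range : i < q → suc (i * 2) < ℓ
  pair-in-range = *-monoˡ-≤ 2

  basis-by-pairs : (P : V ℓ → Set) → (∀ i → i < q → P (e-odd ℓ i) × P (e-even ℓ i)) → ∀ j → P (basis j)
  basis-by-pairs P Ppair j = by-parity (Ppair pair (m<n*o⇒m/o<n (toℕ<n j)))
    where
    pair : ℕ
    pair = toℕ j / 2
    by-parity : P (e-odd ℓ pair) × P (e-even ℓ pair) → P (basis j)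
    by-parity (Podd , Peven) with toℕ j % 2 | m%n<n (toℕ j) 2 | m≡m%n+[m/n]*n (toℕ j) 2
    ... | 0           | _            | toℕj≡ = subst P (trans (e-odd≡E pair) (E-suc≡basis j toℕj≡)) Podd
    ... | 1           | _            | toℕj≡ = subst P (trans (e-even≡E pair) (E-suc≡basis j toℕj≡)) Peven
    ... | suc (suc _) | s≤s (s≤s ()) | _

  χ-involutive : Involutive _≡_ (χ ℓ)
  χ-involutive = additive-involutive χ-additive
    (basis-by-pairs (λ v → χ ℓ (χ ℓ v) ≡ v) (λ i i<q → χ-involutive-on-pair i (pair-in-range i<q)))

  ψ-involutive : Involutive _≡_ (ψ ℓ)
  ψ-involutive = additive-involutive ψ-additive
    (basis-by-pairs (λ v → ψ ℓ (ψ ℓ v) ≡ v) (λ i i<q → ψ-involutive-on-pair i (pair-in-range i<q)))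

  G : (V ℓ → V ℓ) → Set
  G = ⟨ χ ℓ , ψ ℓ , ω ℓ ⟩

  ω≡r-prev : ω ℓ ≡ r (prev ℓ q)
  ω≡r-prev = cong (λ k → r (E ℓ (k ∸ 1) ⊕ E ℓ k)) (*-comm q 2)

  translation-χ : ∀ {w} → G (r w) → G (r (χ ℓ w))
  translation-χ = translation-conjugate gen₁ χ-additive χ-involutive

  translation-ψ : ∀ {w} → G (r w) → G (r (ψ ℓ w))
  translation-ψ = translation-conjugate gen₂ ψ-additive ψ-involutive

  module _ {i : ℕ} (i<q : i < q) (prev-suc∈ : G (r (prev ℓ (suc i)))) where

    e-even-translation : G (r (e-even ℓ i))
    e-even-translation = subst (G ∘ r) (χ-prev-suc i (pair-in-range i<q)) (translation-χ prev-suc∈)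

    e-odd-translation : G (r (e-odd ℓ i))
    e-odd-translation = subst (G ∘ r) (trans (cong (_⊕ e-even ℓ i) (prev-suc i)) (⊕-cancelʳ _ _))
                              (translation-⊕ prev-suc∈ e-even-translation)

    -- ψ (e_{2i+1}) = e_{2i-1} e_{2i} e_{2i+2}, which steps the descent down one pair.
    prev-translation : G (r (prev ℓ i))
    prev-translation =
      subst (G ∘ r) (trans (cong (_⊕ e-even ℓ i) (ψ-e-odd i (pair-in-range i<q))) (⊕-cancelʳ _ _))
            (translation-⊕ (translation-ψ e-odd-translation) e-even-translation)

  prev-translations : ∀ {i} → i ≤ q → G (r (prev ℓ i))
  prev-translations = downward-induction (G ∘ r ∘ prev ℓ) (subst G ω≡r-prev gen₃) prev-translation

  translations : ∀ w → G (r w)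
  translations = translations-from-basis (basis-by-pairs (G ∘ r) (λ i i<q →
    e-odd-translation i<q (prev-translations i<q) , e-even-translation i<q (prev-translations i<q)))

lemma3p1 : ∀ (ℓ : ℕ) → 2 ≤ ℓ → 2 ∣ ℓ →
    Bijective _≡_ _≡_ (χ ℓ) × Bijective _≡_ _≡_ (ψ ℓ) × Bijective _≡_ _≡_ (ω ℓ)
      × Transitive ⟨ χ ℓ , ψ ℓ , ω ℓ ⟩
lemma3p1 .(q * 2) _ (divides q refl) =
  involutive⇒bijective χ-involutive ,
  involutive⇒bijective ψ-involutive ,
  involutive⇒bijective (r-involutive _) ,
  translations⇒transitive translations
  where open EvenRank q
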